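{- Let $D$ be a strongly connected tournament, let $S$ be a minimum feedback arc set of $D$ such that the subdigraph $D_S$ arc-induced by $S$ is a directed path, and let $m=|S|$. Let $k\ge 2$. Then $D$ is $k$-AW if and only if $\gcd(k,F_{m+2})=1$, where $F_n$ denotes the Fibonacci numbers ($F_0=0$, $F_1=1$, $F_n=F_{n-1}+F_{n-2}$).
   Context: A tournament is a digraph in which for every pair of distinct vertices $v,w$ exactly one of $vw$, $wv$ is an arc. For an ordering $\sigma=v_1,\dots,v_n$ of $V(D)$, the feedback arc set with respect to $\sigma$ is the set of arcs $v_jv_i\in A(D)$ with $i<j$. A feedback arc set is a feedback arc set with respect to some ordering; a minimum feedback arc set is one of minimum cardinality over all orderings. For $B\subseteq A(D)$, $D_B$ is the digraph with arc set $B$ and vertex set the vertices incident with an arc of $B$. A digraph is a directed path if its vertices can be ordered $u_1,\dots,u_p$ with arc set exactly $\{u_iu_{i+1}:1\le i\le p-1\}$. The $k$-lights out game on $D$: start with a labeling $\lambda:V(D)\to\mathbb{Z}_k$; toggling a vertex $v$ increases by $1$ (mod $k$) the label of $v$ and of every $w$ with $vw\in A(D)$; the game is won when all labels are $0$. $D$ is $k$-AW if the game can be won from every labeling $V(D)\to\mathbb{Z}_k$. -}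

module Defs where

open import Data.Nat using (ℕ; zero; suc; _+_; _<_; _≤_; _%_)
open import Data.Nat.GCD using (gcd)
open import Data.Fin using (Fin; toℕ; suc) renaming (zero to fzero)
open import Data.Fin.Properties using (_≟_)
open import Data.Bool using (Bool; true; false; _∧_; T; if_then_else_)
open import Data.Product using (Σ; ∃; _×_; _,_)
open import Data.Sum using (_⊎_)
open import Data.List using (List; []; _∷_; map; allFin)
open import Data.Nat.ListAction using (sum)
open import Data.Nat.Divisibility using (_∣_)
open import Data.Empty using (⊥)
open import Relation.Nullary using (¬_; ⌊_⌋)
open import Relation.Binary.PropositionalEquality using (_≡_; _≢_)
open import Function.Bundles using (_↔_; Inverse; _⇔_)
open import Function.Definitions using (Injective)

Digraph : ℕ → Set
Digraph n = Fin n → Fin n → Bool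

IsTournament : ∀ {n} → Digraph n → Set
IsTournament {n} D =
  (∀ (v : Fin n) → D v v ≡ false) ×
  (∀ (v w : Fin n) → v ≢ w → (T (D v w) ⊎ T (D w v)) × ¬ (T (D v w) × T (D w v)))

data Walk {n} (D : Digraph n) : Fin n → Fin n → Set where
  here : ∀ {u} → Walk D u u
  step : ∀ {u w v} → T (D u w) → Walk D w v → Walk D u v

StronglyConnected : ∀ {n} → Digraph n → Set
StronglyConnected {n} D = ∀ (u v : Fin n) → Walk D u v

-- An ordering v_1,...,v_n of V(D): a bijection from vertices to positions.
Ordering : ℕ → Set
Ordering n = Fin n ↔ Fin n

position : ∀ {n} → Ordering n → Fin n → Fin n
position σ = Inverse.to σ

feedback : ∀ {n} → Digraph n → Ordering n → Fin n → Fin n → Bool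
feedback D σ v w = D v w ∧ ⌊ Data.Nat._<?_ (toℕ (position σ w)) (toℕ (position σ v)) ⌋

card : ∀ {n} → (Fin n → Fin n → Bool) → ℕ
card {n} B = sum (map (λ v → sum (map (λ w → if B v w then 1 else 0) (allFin n))) (allFin n))

IsMinimumFASOrdering : ∀ {n} → Digraph n → Ordering n → Set
IsMinimumFASOrdering {n} D σ = ∀ (τ : Ordering n) → card (feedback D σ) ≤ card (feedback D τ)

-- D_B for an arc set B is a directed path: vertices u_0..u_{p-1} (distinct)
-- form exactly the vertex set of D_B (vertices incident with an arc of B),
-- and the arcs of B are exactly u_i u_{i+1}.
Incident : ∀ {n} → (Fin n → Fin n → Bool) → Fin n → Set
Incident {n} B v = ∃ λ (w : Fin n) → T (B v w) ⊎ T (B w v)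

IsDirectedPath : ∀ {n} → (Fin n → Fin n → Bool) → Set
IsDirectedPath {n} B =
  Σ ℕ λ p → Σ (Fin p → Fin n) λ u →
    Injective _≡_ _≡_ u ×
    (∀ (v : Fin n) → Incident B v ⇔ (∃ λ i → u i ≡ v)) ×
    (∀ (i j : Fin p) → T (B (u i) (u j)) ⇔ (toℕ j ≡ suc (toℕ i)))

-- k-lights out: toggling v x_v times adds x_v to v and to every out-neighbour.
-- Final label of w: λ w + x w + Σ_{v : vw arc} x v  (mod k).
finalLabel : ∀ {n} → Digraph n → (Fin n → ℕ) → (Fin n → ℕ) → Fin n → ℕ
finalLabel {n} D lab x w =
  lab w + x w + sum (map (λ v → if D v w then x v else 0) (allFin n))

-- D is k-AW: from every labeling V(D) → ℤ_k the game can be won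
-- (final label ≡ 0 in ℤ_k, i.e. k divides it; toggle counts x v ∈ ℕ, only mod k matters).
IsAW : ∀ {n} → ℕ → Digraph n → Set
IsAW {n} k D =
  ∀ (lab : Fin n → Fin k) → ∃ λ (x : Fin n → ℕ) →
    ∀ (w : Fin n) → k ∣ finalLabel D (λ v → toℕ (lab v)) x w

fib : ℕ → ℕ
fib zero = 0
fib (suc zero) = 1
fib (suc (suc n)) = fib (suc n) + fib n

module Submission where

-- Number the vertices by their positions 0, …, n − 1 in σ. The feedback arcs form a path
-- U₀ → ⋯ → U_m with positions Q₀ > ⋯ > Q_m, so D is the transitive tournament (s → r for s < r) with
-- the arcs Q_{t+1} → Q_t reversed. Minimality forces Q_t ≥ Q_{t+1} + 2 (otherwise swapping the two
-- endpoints removes a feedback arc) and strong connectivity forces Q_m = 0. With toggles Y indexed by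
-- positions, the equation at r is c_r + Σ_{s ≤ r} Y_s plus corrections at path positions. As Q_t − 1
-- is off the path, subtracting the equations at Q_t − 1 and Q_t gives
-- z_{t+1} = z_t + z_{t−1} + (c_{Q_t} − c_{Q_t − 1}) for the path values z_t = Y_{Q_t}. So z_t is
-- F_{t+1} z₀ plus a term fixed by c, and the equation at position 0 becomes F_{m+2} z₀ ≡ (a term fixed
-- by c) mod k, which is solvable for all c iff F_{m+2} is a unit mod k; from such path values the
-- remaining toggles are read off the prefix sums that the equations prescribe.

open import Defs

module LightsOut where

  open import Data.Nat as ℕ using (ℕ; zero; suc; _<_; _≤_; _∸_; z≤n; s≤s)
  import Data.Nat.Properties as ℕₚ
  import Data.Nat.ListAction as ℕ
  import Data.Nat.Divisibility as ℕ
  open import Data.Nat.DivMod using (_mod_; m<n⇒m%n≡m)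
  open import Data.Nat.GCD using (gcd; gcd[m,n]∣m; gcd[m,n]∣n; gcd-zeroʳ; module Bézout)
  open import Data.Nat.Coprimality using (coprime-Bézout; gcd≡1⇒coprime)
  open import Data.Fin as Fin using (Fin; toℕ; fromℕ<)
  import Data.Fin.Properties as Finₚ
  open import Data.Fin.Permutation as Perm using (Permutation; _⟨$⟩ʳ_)
  open import Data.Fin.Permutation.Components using (transpose)
  open import Data.Bool using (Bool; true; false; T; _∧_; if_then_else_)
  import Data.Bool.Properties as Boolₚ
  open import Data.List using (map; allFin)
  import Data.List.Properties as List
  open import Data.Integer using (ℤ; +_; 0ℤ; 1ℤ; _+_; _-_; _*_; -_)
  import Data.Integer.Properties as ℤₚ
  open import Data.Integer.DivMod using (_%ℕ_; _/ℕ_; a≡a%ℕn+[a/ℕn]*n)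
  open import Data.Integer.Divisibility.Signed
    using (_∣_; divides; ∣-trans; ∣m∣n⇒∣m+n; ∣m∣n⇒∣m-n; ∣n⇒∣m*n; ∣ᵤ⇒∣; ∣⇒∣ᵤ)
  open import Data.Integer.Tactic.RingSolver using (solve-∀)
  open import Algebra.Properties.CommutativeMonoid.Sum ℤₚ.+-0-commutativeMonoid
    using (sum-syntax; sum-cong-≗; sum-init-last; sum-replicate-zero; ∑-distrib-+; ∑-comm; ∑-permute)
  open import Algebra.Properties.Semiring.Sum ℤₚ.+-*-semiring using (*-distribʳ-sum)
  open import Data.Product using (∃; ∃₂; _×_; _,_; proj₁; proj₂; map₂)
  open import Data.Sum using (_⊎_; inj₁; inj₂)
  open import Data.Empty using (⊥; ⊥-elim)
  open import Relation.Nullary using (¬_; Dec; yes; no; does)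
  open import Relation.Nullary.Decidable using (dec-true; dec-false; isYes≗does; toWitness)
  open import Relation.Binary using (tri<; tri≈; tri>)
  open import Relation.Binary.PropositionalEquality
  open import Function using (_∘_; id)
  open import Function.Bundles using (_⇔_; Inverse; Equivalence; mk⇔)

  -- Indicators and finite sums of integers

  ⟦_⟧ : Bool → ℤ
  ⟦ b ⟧ = if b then 1ℤ else 0ℤ

  δ : ℕ → ℕ → ℤ
  δ i j = ⟦ does (i ℕ.≟ j) ⟧

  δ< : ℕ → ℕ → ℤ
  δ< s r = ⟦ does (s ℕ.<? r) ⟧

  δ-refl : ∀ i → δ i i ≡ 1ℤ
  δ-refl i = cong ⟦_⟧ (dec-true (i ℕ.≟ i) refl)

  δ-≢ : ∀ {i j} → i ≢ j → δ i j ≡ 0ℤ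
  δ-≢ {i} {j} i≢j = cong ⟦_⟧ (dec-false (i ℕ.≟ j) i≢j)

  δ<-true : ∀ {s r} → s < r → δ< s r ≡ 1ℤ
  δ<-true {s} {r} s<r = cong ⟦_⟧ (dec-true (s ℕ.<? r) s<r)

  δ<-false : ∀ {s r} → ¬ s < r → δ< s r ≡ 0ℤ
  δ<-false {s} {r} s≮r = cong ⟦_⟧ (dec-false (s ℕ.<? r) s≮r)

  δ-comm : ∀ i j → δ i j ≡ δ j i
  δ-comm i j with i ℕ.≟ j
  ... | yes refl = refl
  ... | no i≢j = trans (δ-≢ i≢j) (sym (δ-≢ (i≢j ∘ sym)))

  ∣0 : ∀ {k} → k ∣ 0ℤ
  ∣0 = divides 0ℤ refl

  ∑-distrib-- : ∀ {n} (f g : Fin n → ℤ) → ∑[ i < n ] (f i - g i) ≡ ∑[ i < n ] f i - ∑[ i < n ] g i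
  ∑-distrib-- {zero} f g = refl
  ∑-distrib-- {suc n} f g =
    trans (cong (_+_ (f Fin.zero - g Fin.zero)) (∑-distrib-- (f ∘ Fin.suc) (g ∘ Fin.suc)))
          (interchange (f Fin.zero) (g Fin.zero) _ _)
    where
    interchange : ∀ a b c d → a - b + (c - d) ≡ a + c - (b + d)
    interchange = solve-∀

  ∣-∑ : ∀ {k n} {f : Fin n → ℤ} → (∀ i → k ∣ f i) → k ∣ ∑[ i < n ] f i
  ∣-∑ {n = zero} k∣f = ∣0
  ∣-∑ {n = suc n} k∣f = ∣m∣n⇒∣m+n (k∣f Fin.zero) (∣-∑ (k∣f ∘ Fin.suc))

  sum-allFin-suc : ∀ {n} (f : Fin (suc n) → ℕ) →
                   ℕ.sum (map f (allFin (suc n))) ≡ f Fin.zero ℕ.+ ℕ.sum (map (f ∘ Fin.suc) (allFin n))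
  sum-allFin-suc {n} f = cong (λ xs → f Fin.zero ℕ.+ ℕ.sum xs)
    (trans (List.map-tabulate Fin.suc f) (sym (List.map-tabulate id (f ∘ Fin.suc))))

  ∑-allFin : ∀ n (f : Fin n → ℕ) → + ℕ.sum (map f (allFin n)) ≡ ∑[ i < n ] (+ f i)
  ∑-allFin zero f = refl
  ∑-allFin (suc n) f = begin
    + ℕ.sum (map f (allFin (suc n)))                       ≡⟨ cong +_ (sum-allFin-suc f) ⟩
    + (f Fin.zero ℕ.+ ℕ.sum (map (f ∘ Fin.suc) (allFin n))) ≡⟨ ℤₚ.pos-+ (f Fin.zero) _ ⟩
    + f Fin.zero + + ℕ.sum (map (f ∘ Fin.suc) (allFin n))   ≡⟨ cong (_+_ (+ f Fin.zero)) (∑-allFin n (f ∘ Fin.suc)) ⟩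
    + f Fin.zero + ∑[ i < n ] (+ f (Fin.suc i))             ∎
    where open ≡-Reasoning

  opaque
    ∑< : ℕ → (ℕ → ℤ) → ℤ
    ∑< m f = ∑[ i < m ] f (toℕ i)

    ∑<-zero : ∀ f → ∑< 0 f ≡ 0ℤ
    ∑<-zero f = refl

    ∑<-suc : ∀ m f → ∑< (suc m) f ≡ ∑< m f + f m
    ∑<-suc m f = trans (sum-init-last {m} (f ∘ toℕ))
      (cong₂ _+_ (sum-cong-≗ {m} (cong f ∘ Finₚ.toℕ-inject₁)) (cong f (Finₚ.toℕ-fromℕ m)))

    ∑<-cong : ∀ m {f g : ℕ → ℤ} → (∀ i → i < m → f i ≡ g i) → ∑< m f ≡ ∑< m g
    ∑<-cong m f≡g = sum-cong-≗ (λ i → f≡g (toℕ i) (Finₚ.toℕ<n i))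

    ∑<-distrib-+ : ∀ m (f g : ℕ → ℤ) → ∑< m (λ i → f i + g i) ≡ ∑< m f + ∑< m g
    ∑<-distrib-+ m f g = ∑-distrib-+ {m} (f ∘ toℕ) (g ∘ toℕ)

    ∑<-distrib-- : ∀ m (f g : ℕ → ℤ) → ∑< m (λ i → f i - g i) ≡ ∑< m f - ∑< m g
    ∑<-distrib-- m f g = ∑-distrib-- {m} (f ∘ toℕ) (g ∘ toℕ)

    ∑<-*ʳ : ∀ m (f : ℕ → ℤ) x → ∑< m f * x ≡ ∑< m (λ i → f i * x)
    ∑<-*ʳ m f x = *-distribʳ-sum {m} x (f ∘ toℕ)

    ∑<-comm : ∀ n m (f : ℕ → ℕ → ℤ) → ∑< n (λ s → ∑< m (f s)) ≡ ∑< m (λ i → ∑< n (λ s → f s i))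
    ∑<-comm n m f = ∑-comm {n} {m} (λ s i → f (toℕ s) (toℕ i))

    ∣-∑< : ∀ {k} m {f : ℕ → ℤ} → (∀ i → i < m → k ∣ f i) → k ∣ ∑< m f
    ∣-∑< m k∣f = ∣-∑ (λ i → k∣f (toℕ i) (Finₚ.toℕ<n i))

    ∑-permute-toℕ : ∀ {n} (π : Permutation n n) (f : ℕ → ℤ) → ∑[ v < n ] f (toℕ (π ⟨$⟩ʳ v)) ≡ ∑< n f
    ∑-permute-toℕ π f = sym (∑-permute (f ∘ toℕ) π)

  ∑<-one-term : ∀ f → ∑< 1 f ≡ f 0
  ∑<-one-term f = trans (∑<-suc 0 f) (trans (cong (_+ f 0) (∑<-zero f)) (ℤₚ.+-identityˡ (f 0)))

  ∑<-vanish : ∀ m {f : ℕ → ℤ} → (∀ i → i < m → f i ≡ 0ℤ) → ∑< m f ≡ 0ℤ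
  ∑<-vanish zero {f} _ = ∑<-zero f
  ∑<-vanish (suc m) {f} f≡0 = begin
    ∑< (suc m) f ≡⟨ ∑<-suc m f ⟩
    ∑< m f + f m ≡⟨ cong₂ _+_ (∑<-vanish m (λ i i<m → f≡0 i (ℕₚ.m<n⇒m<1+n i<m))) (f≡0 m ℕₚ.≤-refl) ⟩
    0ℤ           ∎
    where open ≡-Reasoning

  ∑<-one : ∀ m → ∑< m (λ _ → 1ℤ) ≡ + m
  ∑<-one zero = ∑<-zero (λ _ → 1ℤ)
  ∑<-one (suc m) = begin
    ∑< (suc m) (λ _ → 1ℤ) ≡⟨ ∑<-suc m (λ _ → 1ℤ) ⟩
    ∑< m (λ _ → 1ℤ) + 1ℤ  ≡⟨ cong (_+ 1ℤ) (∑<-one m) ⟩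
    + m + 1ℤ              ≡⟨ ℤₚ.pos-+ m 1 ⟨
    + (m ℕ.+ 1)           ≡⟨ cong +_ (ℕₚ.+-comm m 1) ⟩
    + suc m               ∎
    where open ≡-Reasoning

  ∑<-δ : ∀ m {t} (f : ℕ → ℤ) → t < m → ∑< m (λ i → δ t i * f i) ≡ f t
  ∑<-δ (suc m) {t} f t<1+m with t ℕ.≟ m
  ... | yes refl = begin
    ∑< (suc m) (λ i → δ m i * f i)          ≡⟨ ∑<-suc m (λ i → δ m i * f i) ⟩
    ∑< m (λ i → δ m i * f i) + δ m m * f m  ≡⟨ cong₂ _+_ (∑<-vanish m λ i i<m → cong (_* f i) (δ-≢ (ℕₚ.>⇒≢ i<m)))
                                                        (cong (_* f m) (δ-refl m)) ⟩
    0ℤ + 1ℤ * f m                           ≡⟨ trans (ℤₚ.+-identityˡ _) (ℤₚ.*-identityˡ _) ⟩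
    f m                                     ∎
    where open ≡-Reasoning
  ... | no t≢m = begin
    ∑< (suc m) (λ i → δ t i * f i)          ≡⟨ ∑<-suc m (λ i → δ t i * f i) ⟩
    ∑< m (λ i → δ t i * f i) + δ t m * f m  ≡⟨ cong₂ _+_ (∑<-δ m f (ℕₚ.≤∧≢⇒< (ℕₚ.≤-pred t<1+m) t≢m))
                                                        (cong (_* f m) (δ-≢ t≢m)) ⟩
    f t + 0ℤ * f m                          ≡⟨ ℤₚ.+-identityʳ (f t) ⟩
    f t                                     ∎
    where open ≡-Reasoning

  ∑<-δ< : ∀ n r (f : ℕ → ℤ) → r ≤ n → ∑< n (λ s → δ< s r * f s) ≡ ∑< r f
  ∑<-δ< zero zero f _ = trans (∑<-zero (λ s → δ< s zero * f s)) (sym (∑<-zero f))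
  ∑<-δ< (suc n) r f r≤1+n with r ℕ.≟ suc n
  ... | yes refl = ∑<-cong (suc n) λ s s<r → trans (cong (_* f s) (δ<-true s<r)) (ℤₚ.*-identityˡ (f s))
  ... | no r≢1+n = begin
    ∑< (suc n) (λ s → δ< s r * f s)          ≡⟨ ∑<-suc n (λ s → δ< s r * f s) ⟩
    ∑< n (λ s → δ< s r * f s) + δ< n r * f n ≡⟨ cong₂ _+_ (∑<-δ< n r f r≤n) (cong (_* f n) (δ<-false (ℕₚ.≤⇒≯ r≤n))) ⟩
    ∑< r f + 0ℤ * f n                        ≡⟨ ℤₚ.+-identityʳ _ ⟩
    ∑< r f                                   ∎
    where
    open ≡-Reasoning
    r≤n : r ≤ n
    r≤n = ℕₚ.≤-pred (ℕₚ.≤∧≢⇒< r≤1+n r≢1+n)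

  ∑<-point-masses : ∀ n m (h : ℕ → ℕ) (w Y : ℕ → ℤ) → (∀ i → i < m → h i < n) →
                    ∑< n (λ s → ∑< m (λ i → δ s (h i) * w i) * Y s) ≡ ∑< m (λ i → w i * Y (h i))
  ∑<-point-masses n m h w Y h<n = begin
    ∑< n (λ s → ∑< m (λ i → δ s (h i) * w i) * Y s)   ≡⟨ ∑<-cong n (λ s _ → ∑<-*ʳ m (λ i → δ s (h i) * w i) (Y s)) ⟩
    ∑< n (λ s → ∑< m (λ i → δ s (h i) * w i * Y s))   ≡⟨ ∑<-comm n m (λ s i → δ s (h i) * w i * Y s) ⟩
    ∑< m (λ i → ∑< n (λ s → δ s (h i) * w i * Y s))   ≡⟨ ∑<-cong m (λ i i<m → pick i (h<n i i<m)) ⟩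
    ∑< m (λ i → w i * Y (h i))                         ∎
    where
    open ≡-Reasoning
    regroup : ∀ d w y → d * w * y ≡ d * (w * y)
    regroup = solve-∀
    pick : ∀ i → h i < n → ∑< n (λ s → δ s (h i) * w i * Y s) ≡ w i * Y (h i)
    pick i hi<n = trans (∑<-cong n λ s _ → trans (regroup (δ s (h i)) (w i) (Y s)) (cong (_* (w i * Y s)) (δ-comm s (h i))))
                        (∑<-δ n (λ s → w i * Y s) hi<n)

  prev : (ℕ → ℤ) → ℕ → ℤ
  prev f zero = 0ℤ
  prev f (suc t) = f t

  ∑<-telescope : ∀ r (P : ℕ → ℤ) → ∑< (suc r) (λ s → P s - prev P s) ≡ P r
  ∑<-telescope zero P = trans (∑<-one-term (λ s → P s - prev P s)) (ℤₚ.+-identityʳ (P 0))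
  ∑<-telescope (suc r) P = begin
    ∑< (suc (suc r)) (λ s → P s - prev P s)               ≡⟨ ∑<-suc (suc r) (λ s → P s - prev P s) ⟩
    ∑< (suc r) (λ s → P s - prev P s) + (P (suc r) - P r) ≡⟨ cong (_+ (P (suc r) - P r)) (∑<-telescope r P) ⟩
    P r + (P (suc r) - P r)                               ≡⟨ cancel (P r) (P (suc r)) ⟩
    P (suc r)                                             ∎
    where
    open ≡-Reasoning
    cancel : ∀ a b → a + (b - a) ≡ b
    cancel = solve-∀

  -- Fibonacci recurrences

  fib-+ : ∀ t → + fib (suc (suc t)) ≡ + fib (suc t) + + fib t
  fib-+ t = ℤₚ.pos-+ (fib (suc t)) (fib t)

  fibonacci-mod : ∀ {g} m (z : ℕ → ℤ) → (∀ t → t < m → + g ∣ z (suc t) - (z t + prev z t)) →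
                  ∀ t → t ≤ m → + g ∣ z t - + fib (suc t) * z 0
  fibonacci-mod m z rec zero _ = subst (_ ∣_) (cancel (z 0)) ∣0
    where
    cancel : ∀ a → 0ℤ ≡ a - 1ℤ * a
    cancel = solve-∀
  fibonacci-mod m z rec (suc zero) 1≤m = subst (_ ∣_) (rearrange (z 1) (z 0)) (rec 0 1≤m)
    where
    rearrange : ∀ a b → a - (b + 0ℤ) ≡ a - 1ℤ * b
    rearrange = solve-∀
  fibonacci-mod m z rec (suc (suc t)) 2+t≤m = subst (_ ∣_) combine
      (∣m∣n⇒∣m+n (∣m∣n⇒∣m+n (rec (suc t) 2+t≤m) (fibonacci-mod m z rec (suc t) (ℕₚ.<⇒≤ 2+t≤m)))
                 (fibonacci-mod m z rec t (ℕₚ.≤-trans (ℕₚ.n≤1+n t) (ℕₚ.<⇒≤ 2+t≤m))))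
    where
    F₂ = + fib (suc (suc t))
    F₁ = + fib (suc t)
    rearrange : ∀ a b c F₂ F₁ x → a - (b + c) + (b - F₂ * x) + (c - F₁ * x) ≡ a - (F₂ + F₁) * x
    rearrange = solve-∀
    combine : z (suc (suc t)) - (z (suc t) + z t) + (z (suc t) - F₂ * z 0) + (z t - F₁ * z 0)
            ≡ z (suc (suc t)) - + fib (suc (suc (suc t))) * z 0
    combine = trans (rearrange (z (suc (suc t))) (z (suc t)) (z t) F₂ F₁ (z 0))
                    (cong (λ F → z (suc (suc t)) - F * z 0) (sym (fib-+ (suc t))))

  forcedFib : (ℕ → ℤ) → ℤ → ℕ → ℤ
  forcedFib e s zero = s
  forcedFib e s (suc zero) = s + e 0
  forcedFib e s (suc (suc t)) = forcedFib e s (suc t) + forcedFib e s t + e (suc t)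

  forcedFib-step : ∀ e s t → forcedFib e s (suc t) ≡ forcedFib e s t + prev (forcedFib e s) t + e t
  forcedFib-step e s zero = cong (_+ e 0) (sym (ℤₚ.+-identityʳ s))
  forcedFib-step e s (suc t) = refl

  forcedFib-linear : ∀ e s t → forcedFib e s t ≡ + fib (suc t) * s + forcedFib e 0ℤ t
  forcedFib-linear e s zero = base s
    where
    base : ∀ s → s ≡ 1ℤ * s + 0ℤ
    base = solve-∀
  forcedFib-linear e s (suc zero) = base s (e 0)
    where
    base : ∀ s e₀ → s + e₀ ≡ 1ℤ * s + (0ℤ + e₀)
    base = solve-∀
  forcedFib-linear e s (suc (suc t)) = begin
    forcedFib e s (suc t) + forcedFib e s t + e (suc t)
      ≡⟨ cong₂ (λ a b → a + b + e (suc t)) (forcedFib-linear e s (suc t)) (forcedFib-linear e s t) ⟩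
    F₂ * s + h₁ + (F₁ * s + h₀) + e (suc t)
      ≡⟨ regroup F₂ F₁ s h₁ h₀ (e (suc t)) ⟩
    (F₂ + F₁) * s + (h₁ + h₀ + e (suc t))
      ≡⟨ cong (λ F → F * s + forcedFib e 0ℤ (suc (suc t))) (sym (fib-+ (suc t))) ⟩
    + fib (suc (suc (suc t))) * s + forcedFib e 0ℤ (suc (suc t)) ∎
    where
    open ≡-Reasoning
    F₂ = + fib (suc (suc t))
    F₁ = + fib (suc t)
    h₁ = forcedFib e 0ℤ (suc t)
    h₀ = forcedFib e 0ℤ t
    regroup : ∀ F₂ F₁ s h₁ h₀ x → F₂ * s + h₁ + (F₁ * s + h₀) + x ≡ (F₂ + F₁) * s + (h₁ + h₀ + x)
    regroup = solve-∀

  pos-1+*≡* : ∀ {b c d e} → 1 ℕ.+ b ℕ.* c ≡ d ℕ.* e → 1ℤ + + b * + c ≡ + d * + e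
  pos-1+*≡* {b} {c} {d} {e} eq = begin
    1ℤ + + b * + c    ≡⟨ cong (_+_ 1ℤ) (ℤₚ.pos-* b c) ⟨
    + (1 ℕ.+ b ℕ.* c) ≡⟨ cong +_ eq ⟩
    + (d ℕ.* e)       ≡⟨ ℤₚ.pos-* d e ⟩
    + d * + e         ∎
    where open ≡-Reasoning

  inverse-mod : ∀ {k F} → gcd k F ≡ 1 → ∃ λ a → + k ∣ a * + F - 1ℤ
  inverse-mod {k} {F} gcd≡1 with coprime-Bézout (gcd≡1⇒coprime {k} {F} gcd≡1)
  ... | Bézout.+- x y 1+yF≡xk = - + y , divides (- + x) (begin
    - + y * + F - 1ℤ         ≡⟨ negate (+ y) (+ F) ⟩
    - (1ℤ + + y * + F)       ≡⟨ cong -_ (pos-1+*≡* {y} {F} {x} {k} 1+yF≡xk) ⟩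
    - (+ x * + k)            ≡⟨ ℤₚ.neg-distribˡ-* (+ x) (+ k) ⟩
    - + x * + k              ∎)
    where
    open ≡-Reasoning
    negate : ∀ y F → - y * F - 1ℤ ≡ - (1ℤ + y * F)
    negate = solve-∀
  ... | Bézout.-+ x y 1+xk≡yF = + y , divides (+ x) (begin
    + y * + F - 1ℤ           ≡⟨ cong (_- 1ℤ) (pos-1+*≡* {x} {k} {y} {F} 1+xk≡yF) ⟨
    1ℤ + + x * + k - 1ℤ      ≡⟨ cancel (+ x * + k) ⟩
    + x * + k                ∎)
    where
    open ≡-Reasoning
    cancel : ∀ a → 1ℤ + a - 1ℤ ≡ a
    cancel = solve-∀

  -- The game on a tournament laid out by positions

  module PositionGame (n m₀ : ℕ) (Q : ℕ → ℕ)
    (Q-gap : ∀ i → i < suc m₀ → 2 ℕ.+ Q (suc i) ≤ Q i)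
    (Q-end : Q (suc m₀) ≡ 0) (Q-start : Q 0 < n) where

    m : ℕ
    m = suc m₀

    Q-gap-< : ∀ {i j} → i < j → j ≤ m → 2 ℕ.+ Q j ≤ Q i
    Q-gap-< {i} {suc j} (s≤s i≤j) j<m with ℕₚ.m≤n⇒m<n∨m≡n i≤j
    ... | inj₂ refl = Q-gap i j<m
    ... | inj₁ i<j = ℕₚ.≤-trans (ℕₚ.+-monoʳ-≤ 2 (ℕₚ.≤-trans (ℕₚ.m≤n+m _ 2) (Q-gap j j<m))) (Q-gap-< i<j (ℕₚ.<⇒≤ j<m))

    Q-antitone : ∀ {i j} → i ≤ j → j ≤ m → Q j ≤ Q i
    Q-antitone i≤j j≤m with ℕₚ.m≤n⇒m<n∨m≡n i≤j
    ... | inj₂ refl = ℕₚ.≤-refl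
    ... | inj₁ i<j = ℕₚ.≤-trans (ℕₚ.m≤n+m _ 2) (Q-gap-< i<j j≤m)

    Q-injective : ∀ {i j} → i ≤ m → j ≤ m → Q i ≡ Q j → i ≡ j
    Q-injective {i} {j} i≤m j≤m Qi≡Qj with ℕₚ.<-cmp i j
    ... | tri≈ _ i≡j _ = i≡j
    ... | tri< i<j _ _ = ⊥-elim (ℕₚ.<-irrefl (sym Qi≡Qj) (ℕₚ.≤-trans (ℕₚ.n≤1+n _) (Q-gap-< i<j j≤m)))
    ... | tri> _ _ j<i = ⊥-elim (ℕₚ.<-irrefl Qi≡Qj (ℕₚ.≤-trans (ℕₚ.n≤1+n _) (Q-gap-< j<i i≤m)))

    δ-Q : ∀ {i j} → i ≤ m → j ≤ m → δ (Q i) (Q j) ≡ δ i j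
    δ-Q {i} {j} i≤m j≤m with i ℕ.≟ j
    ... | yes refl = trans (δ-refl (Q i)) (sym (δ-refl i))
    ... | no i≢j = trans (δ-≢ (i≢j ∘ Q-injective i≤m j≤m)) (sym (δ-≢ i≢j))

    Q<n : ∀ {t} → t ≤ m → Q t < n
    Q<n t≤m = ℕₚ.≤-<-trans (Q-antitone z≤n t≤m) Q-start

    2≤Q : ∀ {t} → t < m → 2 ≤ Q t
    2≤Q t<m = ℕₚ.≤-trans (ℕₚ.m≤m+n 2 _) (Q-gap-< t<m ℕₚ.≤-refl)

    suc[Q∸1]≡Q : ∀ {t} → t < m → suc (Q t ∸ 1) ≡ Q t
    suc[Q∸1]≡Q t<m = ℕₚ.m+[n∸m]≡n (ℕₚ.≤-trans (s≤s z≤n) (2≤Q t<m))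

    Q∸1<n : ∀ {t} → t < m → Q t ∸ 1 < n
    Q∸1<n t<m = ℕₚ.≤-<-trans (ℕₚ.m∸n≤m _ 1) (Q<n (ℕₚ.<⇒≤ t<m))

    Q∸1-off-path : ∀ {t j} → t < m → j ≤ m → Q t ∸ 1 ≢ Q j
    Q∸1-off-path {t} {j} t<m j≤m with ℕₚ.≤-<-connex j t
    ... | inj₁ j≤t = pred-below (ℕₚ.≤-trans (s≤s z≤n) (2≤Q t<m)) (Q-antitone j≤t (ℕₚ.<⇒≤ t<m))
      where
      pred-below : ∀ {a b} → 1 ≤ a → a ≤ b → a ∸ 1 ≢ b
      pred-below {suc a} _ a<b refl = ℕₚ.<-irrefl refl a<b
    ... | inj₂ t<j = pred-above (Q-gap-< t<j j≤m)
      where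
      pred-above : ∀ {a b} → 2 ℕ.+ b ≤ a → a ∸ 1 ≢ b
      pred-above (s≤s b<a) refl = ℕₚ.<-irrefl refl b<a

    pathArc : ℕ → ℕ → ℤ
    pathArc s r = ∑< m (λ i → δ s (Q i) * δ r (Q (suc i)))

    -- The transitive tournament s → r (s < r) on positions, with each arc Q (suc i) → Q i reversed.
    adjacency : ℕ → ℕ → ℤ
    adjacency s r = δ< s r + (pathArc s r - pathArc r s)

    outcome : (ℕ → ℤ) → (ℕ → ℤ) → ℕ → ℤ
    outcome c Y r = c r + Y r + ∑< n (λ s → adjacency s r * Y s)

    -- The corrections to the prefix sum Σ_{s ≤ r} Y s caused by the reversed arcs: r gains the toggles of
    -- Q i when r = Q (suc i), and loses those of Q (suc i) when r = Q i.
    gained : ℕ → (ℕ → ℤ) → ℤ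
    gained r z = ∑< m (λ i → δ r (Q (suc i)) * z i)

    lost : ℕ → (ℕ → ℤ) → ℤ
    lost r z = ∑< m (λ i → δ r (Q i) * z (suc i))

    ∑<-pathArc-into : ∀ r (Y : ℕ → ℤ) → ∑< n (λ s → pathArc s r * Y s) ≡ gained r (Y ∘ Q)
    ∑<-pathArc-into r Y = ∑<-point-masses n m Q (λ i → δ r (Q (suc i))) Y (λ _ i<m → Q<n (ℕₚ.<⇒≤ i<m))

    ∑<-pathArc-out : ∀ r (Y : ℕ → ℤ) → ∑< n (λ s → pathArc r s * Y s) ≡ lost r (Y ∘ Q)
    ∑<-pathArc-out r Y = trans
      (∑<-cong n (λ s _ → cong (_* Y s) (∑<-cong m (λ i _ → ℤₚ.*-comm (δ r (Q i)) (δ s (Q (suc i)))))))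
      (∑<-point-masses n m (Q ∘ suc) (λ i → δ r (Q i)) Y (λ _ → Q<n))

    outcome-expand : ∀ c Y {r} → r < n → outcome c Y r ≡ c r + ∑< (suc r) Y + (gained r (Y ∘ Q) - lost r (Y ∘ Q))
    outcome-expand c Y {r} r<n = begin
      c r + Y r + ∑< n (λ s → adjacency s r * Y s)
        ≡⟨ cong (_+_ (c r + Y r)) (∑<-cong n (λ s _ → distrib (δ< s r) (pathArc s r) (pathArc r s) (Y s))) ⟩
      c r + Y r + ∑< n (λ s → δ< s r * Y s + (pathArc s r * Y s - pathArc r s * Y s))
        ≡⟨ cong (_+_ (c r + Y r)) (trans (∑<-distrib-+ n (λ s → δ< s r * Y s) _)
             (cong (_+_ (∑< n (λ s → δ< s r * Y s))) (∑<-distrib-- n (λ s → pathArc s r * Y s) (λ s → pathArc r s * Y s)))) ⟩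
      c r + Y r + (∑< n (λ s → δ< s r * Y s) + (∑< n (λ s → pathArc s r * Y s) - ∑< n (λ s → pathArc r s * Y s)))
        ≡⟨ cong₂ (λ a b → c r + Y r + (a + b)) (∑<-δ< n r Y (ℕₚ.<⇒≤ r<n))
                                               (cong₂ _-_ (∑<-pathArc-into r Y) (∑<-pathArc-out r Y)) ⟩
      c r + Y r + (∑< r Y + (gained r (Y ∘ Q) - lost r (Y ∘ Q)))
        ≡⟨ regroup (c r) (Y r) (∑< r Y) (gained r (Y ∘ Q) - lost r (Y ∘ Q)) ⟩
      c r + (∑< r Y + Y r) + (gained r (Y ∘ Q) - lost r (Y ∘ Q))
        ≡⟨ cong (λ a → c r + a + (gained r (Y ∘ Q) - lost r (Y ∘ Q))) (sym (∑<-suc r Y)) ⟩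
      c r + ∑< (suc r) Y + (gained r (Y ∘ Q) - lost r (Y ∘ Q)) ∎
      where
      open ≡-Reasoning
      distrib : ∀ d a b y → (d + (a - b)) * y ≡ d * y + (a * y - b * y)
      distrib = solve-∀
      regroup : ∀ c y p x → c + y + (p + x) ≡ c + (p + y) + x
      regroup = solve-∀

    outcome-resp-mod : ∀ c {k} {Y Y′ : ℕ → ℤ} → (∀ s → + k ∣ Y′ s - Y s) →
                       ∀ r → + k ∣ outcome c Y r → + k ∣ outcome c Y′ r
    outcome-resp-mod c {k} {Y} {Y′} Y≈Y′ r k∣outcome = subst (+ k ∣_) (sym difference)
        (∣m∣n⇒∣m+n k∣outcome (∣m∣n⇒∣m+n (Y≈Y′ r) (∣-∑< n (λ s _ → ∣n⇒∣m*n (adjacency s r) (Y≈Y′ s)))))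
      where
      open ≡-Reasoning
      A : (ℕ → ℤ) → ℤ
      A X = ∑< n (λ s → adjacency s r * X s)
      distrib : ∀ w a b → w * a - w * b ≡ w * (a - b)
      distrib = solve-∀
      regroup : ∀ c y y′ S S′ → c + y′ + S′ ≡ c + y + S + ((y′ - y) + (S′ - S))
      regroup = solve-∀
      difference : outcome c Y′ r ≡ outcome c Y r + ((Y′ r - Y r) + A (λ s → Y′ s - Y s))
      difference = begin
        c r + Y′ r + A Y′                                 ≡⟨ regroup (c r) (Y r) (Y′ r) (A Y) (A Y′) ⟩
        outcome c Y r + ((Y′ r - Y r) + (A Y′ - A Y))     ≡⟨ cong (λ S → outcome c Y r + ((Y′ r - Y r) + S))
                                                               (trans (sym (∑<-distrib-- n _ _))
                                                                      (∑<-cong n (λ s _ → distrib (adjacency s r) (Y′ s) (Y s)))) ⟩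
        outcome c Y r + ((Y′ r - Y r) + A (λ s → Y′ s - Y s)) ∎

    pathArc-Q : ∀ {t} → t < m → pathArc (Q t) (Q (suc t)) ≡ 1ℤ
    pathArc-Q {t} t<m = begin
      ∑< m (λ i → δ (Q t) (Q i) * δ (Q (suc t)) (Q (suc i)))
        ≡⟨ ∑<-cong m (λ i i<m → cong (_* δ (Q (suc t)) (Q (suc i))) (δ-Q (ℕₚ.<⇒≤ t<m) (ℕₚ.<⇒≤ i<m))) ⟩
      ∑< m (λ i → δ t i * δ (Q (suc t)) (Q (suc i)))
        ≡⟨ ∑<-δ m (λ i → δ (Q (suc t)) (Q (suc i))) t<m ⟩
      δ (Q (suc t)) (Q (suc t))
        ≡⟨ δ-refl (Q (suc t)) ⟩
      1ℤ ∎
      where open ≡-Reasoning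

    pathArc-off : ∀ {s r} → (∀ {i} → i < m → s ≡ Q i → r ≡ Q (suc i) → ⊥) → pathArc s r ≡ 0ℤ
    pathArc-off {s} {r} not-on-path = ∑<-vanish m term
      where
      term : ∀ i → i < m → δ s (Q i) * δ r (Q (suc i)) ≡ 0ℤ
      term i i<m with s ℕ.≟ Q i | r ℕ.≟ Q (suc i)
      ... | no s≢Qi | _ = trans (cong (_* δ r (Q (suc i))) (δ-≢ s≢Qi)) (ℤₚ.*-zeroˡ (δ r (Q (suc i))))
      ... | yes _ | no r≢Q1+i = trans (cong (δ s (Q i) *_) (δ-≢ r≢Q1+i)) (ℤₚ.*-zeroʳ (δ s (Q i)))
      ... | yes s≡Qi | yes r≡Q1+i = ⊥-elim (not-on-path i<m s≡Qi r≡Q1+i)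

    ∑<-∑<-pathArc : ∑< n (λ s → ∑< n (λ r → pathArc s r)) ≡ + m
    ∑<-∑<-pathArc = begin
      ∑< n (λ s → ∑< n (λ r → pathArc s r))
        ≡⟨ ∑<-cong n (λ s _ → trans (∑<-cong n (λ r _ → sym (ℤₚ.*-identityʳ (pathArc s r)))) (∑<-pathArc-out s (λ _ → 1ℤ))) ⟩
      ∑< n (λ s → ∑< m (λ i → δ s (Q i) * 1ℤ))
        ≡⟨ ∑<-cong n (λ s _ → sym (ℤₚ.*-identityʳ _)) ⟩
      ∑< n (λ s → ∑< m (λ i → δ s (Q i) * 1ℤ) * 1ℤ)
        ≡⟨ ∑<-point-masses n m Q (λ _ → 1ℤ) (λ _ → 1ℤ) (λ _ i<m → Q<n (ℕₚ.<⇒≤ i<m)) ⟩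
      ∑< m (λ _ → 1ℤ)
        ≡⟨ ∑<-one m ⟩
      + m ∎
      where open ≡-Reasoning

    gained-Q : ∀ z {t} → t ≤ m → gained (Q t) z ≡ prev z t
    gained-Q z {zero} _ = ∑<-vanish m (λ i i<m → cong (_* z i) (trans (δ-Q z≤n i<m) (δ-≢ {0} {suc i} (λ ()))))
    gained-Q z {suc t} t<m = trans (∑<-cong m (λ i i<m → cong (_* z i) (δ-Q t<m i<m))) (∑<-δ m z t<m)

    lost-Q : ∀ z {t} → t < m → lost (Q t) z ≡ z (suc t)
    lost-Q z t<m = trans (∑<-cong m (λ i i<m → cong (_* z (suc i)) (δ-Q (ℕₚ.<⇒≤ t<m) (ℕₚ.<⇒≤ i<m))))
                         (∑<-δ m (z ∘ suc) t<m)

    gained-0 : ∀ z → gained 0 z ≡ z m₀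
    gained-0 z = subst (λ r → gained r z ≡ z m₀) Q-end (gained-Q z ℕₚ.≤-refl)

    lost-0 : ∀ z → lost 0 z ≡ 0ℤ
    lost-0 z = subst (λ r → lost r z ≡ 0ℤ) Q-end
      (∑<-vanish m (λ i i<m → cong (_* z (suc i)) (trans (δ-Q ℕₚ.≤-refl (ℕₚ.<⇒≤ i<m)) (δ-≢ (ℕₚ.>⇒≢ i<m)))))

    module _ {r} (off-path : ∀ {j} → j ≤ m → r ≢ Q j) where

      gained-off-path : ∀ z → gained r z ≡ 0ℤ
      gained-off-path z = ∑<-vanish m (λ i i<m → cong (_* z i) (δ-≢ (off-path i<m)))

      lost-off-path : ∀ z → lost r z ≡ 0ℤ
      lost-off-path z = ∑<-vanish m (λ i i<m → cong (_* z (suc i)) (δ-≢ (off-path (ℕₚ.<⇒≤ i<m))))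

    outcome-on-path : ∀ c Y {t} → t < m →
      outcome c Y (Q t) ≡ c (Q t) + ∑< (Q t) Y + Y (Q t) + (prev (Y ∘ Q) t - Y (Q (suc t)))
    outcome-on-path c Y {t} t<m = begin
      outcome c Y (Q t)
        ≡⟨ outcome-expand c Y (Q<n (ℕₚ.<⇒≤ t<m)) ⟩
      c (Q t) + ∑< (suc (Q t)) Y + (gained (Q t) (Y ∘ Q) - lost (Q t) (Y ∘ Q))
        ≡⟨ cong₂ (λ S d → c (Q t) + S + d) (∑<-suc (Q t) Y) (cong₂ _-_ (gained-Q (Y ∘ Q) (ℕₚ.<⇒≤ t<m)) (lost-Q (Y ∘ Q) t<m)) ⟩
      c (Q t) + (∑< (Q t) Y + Y (Q t)) + (prev (Y ∘ Q) t - Y (Q (suc t)))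
        ≡⟨ cong (_+ (prev (Y ∘ Q) t - Y (Q (suc t)))) (sym (ℤₚ.+-assoc (c (Q t)) _ _)) ⟩
      c (Q t) + ∑< (Q t) Y + Y (Q t) + (prev (Y ∘ Q) t - Y (Q (suc t))) ∎
      where open ≡-Reasoning

    outcome-below-path : ∀ c Y {t} → t < m → outcome c Y (Q t ∸ 1) ≡ c (Q t ∸ 1) + ∑< (Q t) Y
    outcome-below-path c Y {t} t<m = begin
      outcome c Y (Q t ∸ 1)
        ≡⟨ outcome-expand c Y (Q∸1<n t<m) ⟩
      c (Q t ∸ 1) + ∑< (suc (Q t ∸ 1)) Y + (gained (Q t ∸ 1) (Y ∘ Q) - lost (Q t ∸ 1) (Y ∘ Q))
        ≡⟨ cong₂ (λ S d → c (Q t ∸ 1) + ∑< S Y + d) (suc[Q∸1]≡Q t<m)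
                 (cong₂ _-_ (gained-off-path (Q∸1-off-path t<m) (Y ∘ Q)) (lost-off-path (Q∸1-off-path t<m) (Y ∘ Q))) ⟩
      c (Q t ∸ 1) + ∑< (Q t) Y + (0ℤ - 0ℤ)
        ≡⟨ ℤₚ.+-identityʳ _ ⟩
      c (Q t ∸ 1) + ∑< (Q t) Y ∎
      where open ≡-Reasoning

    outcome-at-0 : ∀ c Y → outcome c Y 0 ≡ c 0 + Y (Q m) + Y (Q m₀)
    outcome-at-0 c Y = begin
      outcome c Y 0                              ≡⟨ outcome-expand c Y (ℕₚ.≤-<-trans z≤n Q-start) ⟩
      c 0 + ∑< 1 Y + (gained 0 (Y ∘ Q) - lost 0 (Y ∘ Q)) ≡⟨ cong₂ (λ S d → c 0 + S + d) (∑<-one-term Y)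
                                                                 (cong₂ _-_ (gained-0 (Y ∘ Q)) (lost-0 (Y ∘ Q))) ⟩
      c 0 + Y 0 + (Y (Q m₀) - 0ℤ)                ≡⟨ cong₂ (λ y d → c 0 + y + d) (cong Y (sym Q-end)) (ℤₚ.+-identityʳ _) ⟩
      c 0 + Y (Q m) + Y (Q m₀)                   ∎
      where open ≡-Reasoning

    δ₀ : ℕ → ℤ
    δ₀ r = δ r 0

    module _ {g} (Y : ℕ → ℤ) (solves : ∀ r → r < n → + g ∣ outcome δ₀ Y r) where

      path-recurrence : ∀ t → t < m → + g ∣ Y (Q (suc t)) - (Y (Q t) + prev (Y ∘ Q) t)
      path-recurrence t t<m =
        subst (+ g ∣_) difference (∣m∣n⇒∣m-n (solves (Q t ∸ 1) (Q∸1<n t<m)) (solves (Q t) (Q<n (ℕₚ.<⇒≤ t<m))))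
        where
        open ≡-Reasoning
        rearrange : ∀ S y p y′ → 0ℤ + S - (0ℤ + S + y + (p - y′)) ≡ y′ - (y + p)
        rearrange = solve-∀
        unlabelled : δ₀ (Q t ∸ 1) ≡ 0ℤ × δ₀ (Q t) ≡ 0ℤ
        unlabelled = δ-≢ (λ Qt∸1≡0 → Q∸1-off-path t<m ℕₚ.≤-refl (trans Qt∸1≡0 (sym Q-end)))
                   , δ-≢ (ℕₚ.>⇒≢ (ℕₚ.≤-trans (s≤s z≤n) (2≤Q t<m)))
        difference : outcome δ₀ Y (Q t ∸ 1) - outcome δ₀ Y (Q t) ≡ Y (Q (suc t)) - (Y (Q t) + prev (Y ∘ Q) t)
        difference = begin
          outcome δ₀ Y (Q t ∸ 1) - outcome δ₀ Y (Q t)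
            ≡⟨ cong₂ _-_ (outcome-below-path δ₀ Y t<m) (outcome-on-path δ₀ Y t<m) ⟩
          δ₀ (Q t ∸ 1) + ∑< (Q t) Y - (δ₀ (Q t) + ∑< (Q t) Y + Y (Q t) + (prev (Y ∘ Q) t - Y (Q (suc t))))
            ≡⟨ cong₂ (λ a b → a + ∑< (Q t) Y - (b + ∑< (Q t) Y + Y (Q t) + (prev (Y ∘ Q) t - Y (Q (suc t)))))
                     (proj₁ unlabelled) (proj₂ unlabelled) ⟩
          0ℤ + ∑< (Q t) Y - (0ℤ + ∑< (Q t) Y + Y (Q t) + (prev (Y ∘ Q) t - Y (Q (suc t))))
            ≡⟨ rearrange (∑< (Q t) Y) (Y (Q t)) (prev (Y ∘ Q) t) (Y (Q (suc t))) ⟩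
          Y (Q (suc t)) - (Y (Q t) + prev (Y ∘ Q) t) ∎

      solvable⇒coprime : + g ∣ + fib (suc (suc m)) → g ≡ 1
      solvable⇒coprime g∣F = ℕ.∣1⇒≡1 (∣⇒∣ᵤ (subst (+ g ∣_) identity
          (∣m∣n⇒∣m-n (∣m∣n⇒∣m-n (∣m∣n⇒∣m-n at-0 (fibonacci-mod m z path-recurrence m ℕₚ.≤-refl))
                                (fibonacci-mod m z path-recurrence m₀ (ℕₚ.n≤1+n m₀)))
                     (∣n⇒∣m*n (z 0) g∣F))))
        where
        z = Y ∘ Q
        F₁ = + fib m
        F₂ = + fib (suc m)
        at-0 : + g ∣ 1ℤ + z m + z m₀
        at-0 = subst (+ g ∣_) (outcome-at-0 δ₀ Y) (solves 0 (ℕₚ.≤-<-trans z≤n Q-start))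
        cancel : ∀ a b F₂ F₁ x → 1ℤ + a + b - (a - F₂ * x) - (b - F₁ * x) - x * (F₂ + F₁) ≡ 1ℤ
        cancel = solve-∀
        identity : 1ℤ + z m + z m₀ - (z m - F₂ * z 0) - (z m₀ - F₁ * z 0) - z 0 * + fib (suc (suc m)) ≡ 1ℤ
        identity = trans (cong (λ F → 1ℤ + z m + z m₀ - (z m - F₂ * z 0) - (z m₀ - F₁ * z 0) - z 0 * F) (fib-+ m))
                         (cancel (z m) (z m₀) F₂ F₁ (z 0))

    ∑<-weighted-- : ∀ (w f g : ℕ → ℤ) → ∑< m (λ i → w i * f i) - ∑< m (λ i → w i * g i) ≡ ∑< m (λ i → w i * (f i - g i))
    ∑<-weighted-- w f g = trans (sym (∑<-distrib-- m (λ i → w i * f i) (λ i → w i * g i)))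
                                (∑<-cong m (λ i _ → distrib (w i) (f i) (g i)))
      where
      distrib : ∀ w a b → w * a - w * b ≡ w * (a - b)
      distrib = solve-∀

    module _ (c : ℕ → ℤ) where

      labelJump : ℕ → ℤ
      labelJump t = c (Q t) - c (Q t ∸ 1)

      -- The prefix sums Σ_{s ≤ r} Y s that make the equation at every position r hold exactly as soon as
      -- the toggles on the path are z.
      potential : (ℕ → ℤ) → ℕ → ℤ
      potential z r = - c r - (gained r z - lost r z)

      toggles : (ℕ → ℤ) → ℕ → ℤ
      toggles z r = potential z r - prev (potential z) r

      outcome-toggles : ∀ z {r} → r < n →
        outcome c (toggles z) r ≡ gained r (λ j → toggles z (Q j) - z j) - lost r (λ j → toggles z (Q j) - z j)
      outcome-toggles z {r} r<n = begin
        outcome c Y r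
          ≡⟨ outcome-expand c Y r<n ⟩
        c r + ∑< (suc r) Y + (gained r (Y ∘ Q) - lost r (Y ∘ Q))
          ≡⟨ cong (λ p → c r + p + (gained r (Y ∘ Q) - lost r (Y ∘ Q))) (∑<-telescope r (potential z)) ⟩
        c r + (- c r - (gained r z - lost r z)) + (gained r (Y ∘ Q) - lost r (Y ∘ Q))
          ≡⟨ rearrange (c r) (gained r z) (lost r z) (gained r (Y ∘ Q)) (lost r (Y ∘ Q)) ⟩
        (gained r (Y ∘ Q) - gained r z) - (lost r (Y ∘ Q) - lost r z)
          ≡⟨ cong₂ _-_ (∑<-weighted-- (λ i → δ r (Q (suc i))) (Y ∘ Q) z)
                       (∑<-weighted-- (λ i → δ r (Q i)) (Y ∘ Q ∘ suc) (z ∘ suc)) ⟩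
        gained r (λ j → Y (Q j) - z j) - lost r (λ j → Y (Q j) - z j) ∎
        where
        open ≡-Reasoning
        Y = toggles z
        rearrange : ∀ c G L G′ L′ → c + (- c - (G - L)) + (G′ - L′) ≡ (G′ - G) - (L′ - L)
        rearrange = solve-∀

      toggles-on-path : ∀ z {t} → t < m → toggles z (Q t) ≡ z (suc t) - prev z t - labelJump t
      toggles-on-path z {t} t<m = begin
        potential z (Q t) - prev (potential z) (Q t)
          ≡⟨ cong (λ q → potential z (Q t) - prev (potential z) q) (sym (suc[Q∸1]≡Q t<m)) ⟩
        potential z (Q t) - potential z (Q t ∸ 1)
          ≡⟨ cong₂ (λ a b → - c (Q t) - a - (- c (Q t ∸ 1) - b))
                   (cong₂ _-_ (gained-Q z (ℕₚ.<⇒≤ t<m)) (lost-Q z t<m))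
                   (cong₂ _-_ (gained-off-path off z) (lost-off-path off z)) ⟩
        - c (Q t) - (prev z t - z (suc t)) - (- c (Q t ∸ 1) - (0ℤ - 0ℤ))
          ≡⟨ rearrange (c (Q t)) (c (Q t ∸ 1)) (prev z t) (z (suc t)) ⟩
        z (suc t) - prev z t - labelJump t ∎
        where
        open ≡-Reasoning
        off : ∀ {j} → j ≤ m → Q t ∸ 1 ≢ Q j
        off = Q∸1-off-path t<m
        rearrange : ∀ a b p z′ → - a - (p - z′) - (- b - (0ℤ - 0ℤ)) ≡ z′ - p - (a - b)
        rearrange = solve-∀

      toggles-end : ∀ z → toggles z (Q m) ≡ - c 0 - z m₀
      toggles-end z = begin
        potential z (Q m) - prev (potential z) (Q m) ≡⟨ cong (λ r → potential z r - prev (potential z) r) Q-end ⟩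
        - c 0 - (gained 0 z - lost 0 z) - 0ℤ         ≡⟨ cong (λ d → - c 0 - d - 0ℤ) (cong₂ _-_ (gained-0 z) (lost-0 z)) ⟩
        - c 0 - (z m₀ - 0ℤ) - 0ℤ                     ≡⟨ simplify (c 0) (z m₀) ⟩
        - c 0 - z m₀                                 ∎
        where
        open ≡-Reasoning
        simplify : ∀ a b → - a - (b - 0ℤ) - 0ℤ ≡ - a - b
        simplify = solve-∀

      module _ (a : ℤ) where

        offset : ℤ
        offset = forcedFib labelJump 0ℤ m + forcedFib labelJump 0ℤ m₀ + c 0

        -- The start value makes the equation at position 0, z m + z m₀ + c 0 ≡ 0, hold modulo k
        -- whenever a is an inverse of F (m + 2) modulo k.
        pathValues : ℕ → ℤ
        pathValues = forcedFib labelJump (- (a * offset))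

        solution : ℕ → ℤ
        solution = toggles pathValues

        solution-on-path : ∀ {t} → t < m → solution (Q t) ≡ pathValues t
        solution-on-path {t} t<m = trans (toggles-on-path pathValues t<m)
          (trans (cong (λ x → x - prev pathValues t - labelJump t) (forcedFib-step labelJump (- (a * offset)) t))
                 (cancel (pathValues t) (prev pathValues t) (labelJump t)))
          where
          cancel : ∀ x p e → x + p + e - p - e ≡ x
          cancel = solve-∀

        solution-end : solution (Q m) - pathValues m ≡ offset * (a * + fib (suc (suc m)) - 1ℤ)
        solution-end = begin
          solution (Q m) - pathValues m
            ≡⟨ cong (_- pathValues m) (toggles-end pathValues) ⟩
          - c 0 - pathValues m₀ - pathValues m
            ≡⟨ cong₂ (λ x y → - c 0 - x - y) (forcedFib-linear labelJump s m₀) (forcedFib-linear labelJump s m) ⟩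
          - c 0 - (F₁ * s + h₀) - (F₂ * s + h₁)
            ≡⟨ rearrange (c 0) F₁ F₂ h₀ h₁ a ⟩
          (h₁ + h₀ + c 0) * (a * (F₂ + F₁) - 1ℤ)
            ≡⟨ cong (λ F → offset * (a * F - 1ℤ)) (sym (fib-+ m)) ⟩
          offset * (a * + fib (suc (suc m)) - 1ℤ) ∎
          where
          open ≡-Reasoning
          s = - (a * offset)
          F₁ = + fib m
          F₂ = + fib (suc m)
          h₀ = forcedFib labelJump 0ℤ m₀
          h₁ = forcedFib labelJump 0ℤ m
          rearrange : ∀ c F₁ F₂ h₀ h₁ a →
            - c - (F₁ * - (a * (h₁ + h₀ + c)) + h₀) - (F₂ * - (a * (h₁ + h₀ + c)) + h₁) ≡ (h₁ + h₀ + c) * (a * (F₂ + F₁) - 1ℤ)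
          rearrange = solve-∀

      solution-solves : ∀ {k} a → + k ∣ a * + fib (suc (suc m)) - 1ℤ → ∀ {r} → r < n → + k ∣ outcome c (solution a) r
      solution-solves {k} a inverse {r} r<n = subst (+ k ∣_) (sym (outcome-toggles (pathValues a) r<n))
        (∣m∣n⇒∣m-n (∣-∑< m (λ i i<m → ∣n⇒∣m*n (δ r (Q (suc i))) (on-path (ℕₚ.<⇒≤ i<m))))
                   (∣-∑< m (λ i i<m → ∣n⇒∣m*n (δ r (Q i)) (on-path i<m))))
        where
        on-path : ∀ {j} → j ≤ m → + k ∣ solution a (Q j) - pathValues a j
        on-path {j} j≤m with ℕₚ.m≤n⇒m<n∨m≡n j≤m
        ... | inj₁ j<m = subst (+ k ∣_) (sym (trans (cong (_- pathValues a j) (solution-on-path a j<m))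
                                                    (ℤₚ.+-inverseʳ (pathValues a j)))) ∣0
        ... | inj₂ refl = subst (+ k ∣_) (sym (solution-end a)) (∣n⇒∣m*n (offset a) inverse)

  -- Orderings of a tournament and their feedback arcs

  sum-allFin-mono : ∀ {n} {f g : Fin n → ℕ} → (∀ i → f i ≤ g i) →
                    ℕ.sum (map f (allFin n)) ≤ ℕ.sum (map g (allFin n))
  sum-allFin-mono {zero} f≤g = z≤n
  sum-allFin-mono {suc n} {f} {g} f≤g = subst₂ _≤_ (sym (sum-allFin-suc f)) (sym (sum-allFin-suc g))
    (ℕₚ.+-mono-≤ (f≤g Fin.zero) (sum-allFin-mono (f≤g ∘ Fin.suc)))

  sum-allFin-mono-< : ∀ {n} {f g : Fin n → ℕ} → (∀ i → f i ≤ g i) → ∀ {i} → f i < g i →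
                      ℕ.sum (map f (allFin n)) < ℕ.sum (map g (allFin n))
  sum-allFin-mono-< {suc n} {f} {g} f≤g {Fin.zero} fi<gi =
    subst₂ _<_ (sym (sum-allFin-suc f)) (sym (sum-allFin-suc g))
      (ℕₚ.+-mono-<-≤ fi<gi (sum-allFin-mono (f≤g ∘ Fin.suc)))
  sum-allFin-mono-< {suc n} {f} {g} f≤g {Fin.suc i} fi<gi =
    subst₂ _<_ (sym (sum-allFin-suc f)) (sym (sum-allFin-suc g))
      (ℕₚ.+-mono-≤-< (f≤g Fin.zero) (sum-allFin-mono-< (f≤g ∘ Fin.suc) fi<gi))

  card-mono-< : ∀ {n} {B B′ : Fin n → Fin n → Bool} → (∀ v w → T (B′ v w) → T (B v w)) →
                ∀ {v w} → T (B v w) → ¬ T (B′ v w) → card B′ < card B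
  card-mono-< {B = B} {B′} B′⊆B {v} {w} t ¬t′ =
    sum-allFin-mono-< (λ x → sum-allFin-mono (λ y → indicator-mono (B′⊆B x y))) {v}
      (sum-allFin-mono-< (λ y → indicator-mono (B′⊆B v y)) {w} (indicator-mono-< t ¬t′))
    where
    indicator-mono : ∀ {b b′} → (T b′ → T b) → (if b′ then 1 else 0) ≤ (if b then 1 else 0)
    indicator-mono {true} {true} _ = ℕₚ.≤-refl
    indicator-mono {false} {true} b′⇒b = ⊥-elim (b′⇒b _)
    indicator-mono {_} {false} _ = z≤n
    indicator-mono-< : ∀ {b b′} → T b → ¬ T b′ → (if b′ then 1 else 0) < (if b then 1 else 0)
    indicator-mono-< {true} {false} _ _ = s≤s z≤n
    indicator-mono-< {true} {true} _ ¬t = ⊥-elim (¬t _)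

  card-∑ : ∀ {n} (B : Fin n → Fin n → Bool) → + card B ≡ ∑[ v < n ] ∑[ w < n ] ⟦ B v w ⟧
  card-∑ {n} B = trans (∑-allFin n _) (sum-cong-≗ λ v → trans (∑-allFin n _) (sum-cong-≗ λ w → indicator (B v w)))
    where
    indicator : ∀ b → + (if b then 1 else 0) ≡ ⟦ b ⟧
    indicator true = refl
    indicator false = refl

  transpose-matchˡ : ∀ {n} (a b : Fin n) → transpose a b a ≡ b
  transpose-matchˡ a b rewrite dec-true (a Finₚ.≟ a) refl = refl

  transpose-matchʳ : ∀ {n} {a b : Fin n} → b ≢ a → transpose a b b ≡ a
  transpose-matchʳ {a = a} {b} b≢a rewrite dec-false (b Finₚ.≟ a) b≢a | dec-true (b Finₚ.≟ b) refl = refl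

  transpose-other : ∀ {n} {a b k : Fin n} → k ≢ a → k ≢ b → transpose a b k ≡ k
  transpose-other {a = a} {b} {k} k≢a k≢b rewrite dec-false (k Finₚ.≟ a) k≢a | dec-false (k Finₚ.≟ b) k≢b = refl

  module _ {n} {a b : Fin n} (b≡1+a : toℕ b ≡ suc (toℕ a)) where

    adjacent-≢ : b ≢ a
    adjacent-≢ b≡a = ℕₚ.1+n≢n (trans (sym b≡1+a) (cong toℕ b≡a))

    private
      A = toℕ a
      b≢a = adjacent-≢

      τ : Fin n → ℕ
      τ k = toℕ (transpose a b k)

      τ-a : ∀ {k} → k ≡ a → τ k ≡ suc A
      τ-a refl = trans (cong toℕ (transpose-matchˡ a b)) b≡1+a

      τ-b : ∀ {k} → k ≡ b → τ k ≡ A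
      τ-b refl = cong toℕ (transpose-matchʳ b≢a)

      τ-other : ∀ {k} → k ≢ a → k ≢ b → τ k ≡ toℕ k
      τ-other k≢a k≢b = cong toℕ (transpose-other k≢a k≢b)

      toℕ-≢ : ∀ {k l : Fin n} → k ≢ l → toℕ k ≢ toℕ l
      toℕ-≢ k≢l = k≢l ∘ Finₚ.toℕ-injective

    transpose-adjacent-inversion : ∀ x y → toℕ (transpose a b y) < toℕ (transpose a b x) →
                                   toℕ y < toℕ x ⊎ (y ≡ b × x ≡ a)
    transpose-adjacent-inversion x y τy<τx = cases (x Finₚ.≟ a) (x Finₚ.≟ b) (y Finₚ.≟ a) (y Finₚ.≟ b)
      where
      cases : Dec (x ≡ a) → Dec (x ≡ b) → Dec (y ≡ a) → Dec (y ≡ b) → toℕ y < toℕ x ⊎ (y ≡ b × x ≡ a)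
      cases (yes x≡a) _ (yes y≡a) _ = ⊥-elim (ℕₚ.<-irrefl refl (subst₂ _<_ (τ-a y≡a) (τ-a x≡a) τy<τx))
      cases (yes x≡a) _ (no _) (yes y≡b) = inj₂ (y≡b , x≡a)
      cases (yes x≡a) _ (no y≢a) (no y≢b) = inj₁ (subst (toℕ y <_) (sym (cong toℕ x≡a))
        (ℕₚ.≤∧≢⇒< (ℕₚ.≤-pred (subst₂ _<_ (τ-other y≢a y≢b) (τ-a x≡a) τy<τx)) (toℕ-≢ y≢a)))
      cases (no _) (yes x≡b) (yes y≡a) _ = ⊥-elim (ℕₚ.<-asym (subst₂ _<_ (τ-a y≡a) (τ-b x≡b) τy<τx) (ℕₚ.n<1+n A))
      cases (no _) (yes x≡b) (no _) (yes y≡b) = ⊥-elim (ℕₚ.<-irrefl refl (subst₂ _<_ (τ-b y≡b) (τ-b x≡b) τy<τx))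
      cases (no _) (yes x≡b) (no y≢a) (no y≢b) = inj₁ (subst (toℕ y <_) (trans (sym b≡1+a) (sym (cong toℕ x≡b)))
        (ℕₚ.m<n⇒m<1+n (subst₂ _<_ (τ-other y≢a y≢b) (τ-b x≡b) τy<τx)))
      cases (no x≢a) (no x≢b) (yes y≡a) _ = inj₁ (subst (_< toℕ x) (sym (cong toℕ y≡a))
        (ℕₚ.<-trans (ℕₚ.n<1+n A) (subst₂ _<_ (τ-a y≡a) (τ-other x≢a x≢b) τy<τx)))
      cases (no x≢a) (no x≢b) (no _) (yes y≡b) = inj₁ (subst (_< toℕ x) (sym (trans (cong toℕ y≡b) b≡1+a))
        (ℕₚ.≤∧≢⇒< (subst₂ _<_ (τ-b y≡b) (τ-other x≢a x≢b) τy<τx) (λ 1+A≡x → toℕ-≢ x≢b (trans (sym 1+A≡x) (sym b≡1+a)))))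
      cases (no x≢a) (no x≢b) (no y≢a) (no y≢b) = inj₁ (subst₂ _<_ (τ-other y≢a y≢b) (τ-other x≢a x≢b) τy<τx)

  module Ordered {n} (D : Digraph n) (σ : Ordering n) where

    pos : Fin n → ℕ
    pos v = toℕ (position σ v)

    pos<n : ∀ v → pos v < n
    pos<n v = Finₚ.toℕ<n (position σ v)

    pos-injective : ∀ {v w} → pos v ≡ pos w → v ≡ w
    pos-injective {v} {w} eq = begin
      v                                    ≡⟨ Inverse.strictlyInverseʳ σ v ⟨
      Inverse.from σ (position σ v)        ≡⟨ cong (Inverse.from σ) (Finₚ.toℕ-injective eq) ⟩
      Inverse.from σ (position σ w)        ≡⟨ Inverse.strictlyInverseʳ σ w ⟩
      w                                    ∎
      where open ≡-Reasoning

    F : Fin n → Fin n → Bool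
    F = feedback D σ

    feedback-forward : ∀ {v w} → pos w < pos v → F v w ≡ D v w
    feedback-forward {v} {w} lt = trans (cong (D v w ∧_) (trans (isYes≗does w<?v) (dec-true w<?v lt))) (Boolₚ.∧-identityʳ (D v w))
      where w<?v = pos w ℕ.<? pos v

    feedback-backward : ∀ {v w} → ¬ pos w < pos v → F v w ≡ false
    feedback-backward {v} {w} ¬lt = trans (cong (D v w ∧_) (trans (isYes≗does w<?v) (dec-false w<?v ¬lt))) (Boolₚ.∧-zeroʳ (D v w))
      where w<?v = pos w ℕ.<? pos v

    feedback⇒ : ∀ {v w} → T (F v w) → T (D v w) × pos w < pos v
    feedback⇒ {v} {w} t = map₂ (toWitness {a? = pos w ℕ.<? pos v}) (Equivalence.to Boolₚ.T-∧ t)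

    ⇒feedback : ∀ {v w} → T (D v w) → pos w < pos v → T (F v w)
    ⇒feedback d lt = subst T (sym (feedback-forward lt)) d

    tournament-arc : IsTournament D → ∀ v w → ⟦ D v w ⟧ ≡ δ< (pos v) (pos w) + (⟦ F v w ⟧ - ⟦ F w v ⟧)
    tournament-arc (loopless , oriented) v w with ℕₚ.<-cmp (pos v) (pos w)
    ... | tri< v<w _ _ = begin
      ⟦ D v w ⟧                                    ≡⟨ exactly-one (oriented v w (λ v≡w → ℕₚ.<-irrefl (cong pos v≡w) v<w)) ⟩
      1ℤ + (0ℤ - ⟦ D w v ⟧)                        ≡⟨ cong₂ (λ x b → x + (⟦ b ⟧ - ⟦ D w v ⟧))
                                                            (sym (δ<-true v<w)) (sym (feedback-backward (ℕₚ.<⇒≯ v<w))) ⟩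
      δ< (pos v) (pos w) + (⟦ F v w ⟧ - ⟦ D w v ⟧) ≡⟨ cong (λ b → δ< (pos v) (pos w) + (⟦ F v w ⟧ - ⟦ b ⟧))
                                                           (sym (feedback-forward v<w)) ⟩
      δ< (pos v) (pos w) + (⟦ F v w ⟧ - ⟦ F w v ⟧) ∎
      where
      open ≡-Reasoning
      exactly-one : ∀ {b c} → (T b ⊎ T c) × ¬ (T b × T c) → ⟦ b ⟧ ≡ 1ℤ + (0ℤ - ⟦ c ⟧)
      exactly-one {true} {false} _ = refl
      exactly-one {false} {true} _ = refl
      exactly-one {true} {true} (_ , ¬both) = ⊥-elim (¬both _)
      exactly-one {false} {false} (inj₁ () , _)
      exactly-one {false} {false} (inj₂ () , _)
    ... | tri> _ _ w<v = begin
      ⟦ D v w ⟧                                    ≡⟨ trans (sym (ℤₚ.+-identityʳ _)) (sym (ℤₚ.+-identityˡ _)) ⟩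
      0ℤ + (⟦ D v w ⟧ - 0ℤ)                        ≡⟨ cong₂ (λ x b → x + (⟦ D v w ⟧ - ⟦ b ⟧))
                                                            (sym (δ<-false (ℕₚ.<⇒≯ w<v))) (sym (feedback-backward (ℕₚ.<⇒≯ w<v))) ⟩
      δ< (pos v) (pos w) + (⟦ D v w ⟧ - ⟦ F w v ⟧) ≡⟨ cong (λ b → δ< (pos v) (pos w) + (⟦ b ⟧ - ⟦ F w v ⟧))
                                                           (sym (feedback-forward w<v)) ⟩
      δ< (pos v) (pos w) + (⟦ F v w ⟧ - ⟦ F w v ⟧) ∎
      where open ≡-Reasoning
    ... | tri≈ _ v≡w _ with pos-injective v≡w
    ... | refl = begin
      ⟦ D v v ⟧                                    ≡⟨ cong ⟦_⟧ (loopless v) ⟩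
      0ℤ + (0ℤ - 0ℤ)                               ≡⟨ cong₂ (λ x b → x + (⟦ b ⟧ - ⟦ b ⟧))
                                                            (sym (δ<-false {pos v} (ℕₚ.<-irrefl refl)))
                                                            (sym (feedback-backward {v} (ℕₚ.<-irrefl refl))) ⟩
      δ< (pos v) (pos v) + (⟦ F v v ⟧ - ⟦ F v v ⟧) ∎
      where open ≡-Reasoning

    walk-crosses : ∀ r {a b} → Walk D a b → r ≤ pos a → pos b < r → ∃₂ λ v w → T (F v w) × pos w < r
    walk-crosses r here r≤a b<r = ⊥-elim (ℕₚ.<-irrefl refl (ℕₚ.<-≤-trans b<r r≤a))
    walk-crosses r {a} (step {w = w} d rest) r≤a b<r with pos w ℕ.<? r
    ... | yes w<r = a , w , ⇒feedback d (ℕₚ.<-≤-trans w<r r≤a) , w<r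
    ... | no w≮r = walk-crosses r rest (ℕₚ.≮⇒≥ w≮r) b<r

    adjacent-feedback-removable : IsTournament D → ∀ {v w} → T (F v w) → pos v ≡ suc (pos w) →
                                  ∃ λ (τ : Ordering n) → card (feedback D τ) < card F
    adjacent-feedback-removable (_ , oriented) {v} {w} f pv≡1+pw =
      τ , card-mono-< feedback-shrinks f (λ t → ℕₚ.<-asym (swapped (proj₂ (τ-feedback⇒ t))) (ℕₚ.≤-reflexive (sym pv≡1+pw)))
      where
      a = position σ w
      b = position σ v
      τ : Ordering n
      τ = σ Perm.∘ₚ Perm.transpose a b
      τpos : Fin n → ℕ
      τpos x = toℕ (transpose a b (position σ x))
      τ-feedback⇒ : ∀ {x y} → T (feedback D τ x y) → T (D x y) × τpos y < τpos x
      τ-feedback⇒ {x} {y} t = map₂ (toWitness {a? = τpos y ℕ.<? τpos x}) (Equivalence.to Boolₚ.T-∧ t)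
      swapped : toℕ (transpose a b a) < toℕ (transpose a b b) → pos v < pos w
      swapped = subst₂ _<_ (cong toℕ (transpose-matchˡ a b)) (cong toℕ (transpose-matchʳ (adjacent-≢ pv≡1+pw)))
      vw-arc : T (D v w)
      vw-arc = proj₁ (feedback⇒ f)
      feedback-shrinks : ∀ x y → T (feedback D τ x y) → T (F x y)
      feedback-shrinks x y t with τ-feedback⇒ t
      ... | d , lt with transpose-adjacent-inversion pv≡1+pw (position σ x) (position σ y) lt
      ... | inj₁ y<x = ⇒feedback d y<x
      ... | inj₂ (σy≡b , σx≡a) = ⊥-elim (proj₂ (oriented v w v≢w) (vw-arc , subst₂ (λ p q → T (D p q)) x≡w y≡v d))
        where
        x≡w = pos-injective (cong toℕ σx≡a)
        y≡v = pos-injective (cong toℕ σy≡b)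
        v≢w : v ≢ w
        v≢w v≡w = ℕₚ.1+n≢n (trans (sym pv≡1+pw) (cong pos v≡w))

    vertex : .{{ℕ.NonZero n}} → ℕ → Fin n
    vertex r = Inverse.from σ (r mod n)

    pos-vertex : .{{_ : ℕ.NonZero n}} → ∀ {r} → r < n → pos (vertex r) ≡ r
    pos-vertex {r} r<n = begin
      toℕ (Inverse.to σ (Inverse.from σ (r mod n))) ≡⟨ cong toℕ (Inverse.strictlyInverseˡ σ (r mod n)) ⟩
      toℕ (r mod n)                                 ≡⟨ Finₚ.toℕ-fromℕ< _ ⟩
      r ℕ.% n                                       ≡⟨ m<n⇒m%n≡m r<n ⟩
      r                                             ∎
      where open ≡-Reasoning

    vertex-pos : .{{_ : ℕ.NonZero n}} → ∀ v → vertex (pos v) ≡ v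
    vertex-pos v = pos-injective (pos-vertex (pos<n v))

    finalLabel-in-positions : (A : ℕ → ℕ → ℤ) → (∀ v w → ⟦ D v w ⟧ ≡ A (pos v) (pos w)) →
      ∀ lab x (c Y : ℕ → ℤ) → (∀ v → + lab v ≡ c (pos v)) → (∀ v → + x v ≡ Y (pos v)) →
      ∀ w → + finalLabel D lab x w ≡ c (pos w) + Y (pos w) + ∑< n (λ s → A s (pos w) * Y s)
    finalLabel-in-positions A D≡A lab x c Y lab≡c x≡Y w = begin
      + finalLabel D lab x w
        ≡⟨ trans (ℤₚ.pos-+ (lab w ℕ.+ x w) _) (cong (_+ + ℕ.sum (map arcs (allFin n))) (ℤₚ.pos-+ (lab w) (x w))) ⟩
      + lab w + + x w + + ℕ.sum (map arcs (allFin n))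
        ≡⟨ cong₂ _+_ (cong₂ _+_ (lab≡c w) (x≡Y w)) (∑-allFin n arcs) ⟩
      c (pos w) + Y (pos w) + ∑[ v < n ] (+ arcs v)
        ≡⟨ cong (_+_ (c (pos w) + Y (pos w))) (sum-cong-≗ arcs-pos) ⟩
      c (pos w) + Y (pos w) + ∑[ v < n ] (A (pos v) (pos w) * Y (pos v))
        ≡⟨ cong (_+_ (c (pos w) + Y (pos w))) (∑-permute-toℕ σ (λ s → A s (pos w) * Y s)) ⟩
      c (pos w) + Y (pos w) + ∑< n (λ s → A s (pos w) * Y s) ∎
      where
      open ≡-Reasoning
      arcs : Fin n → ℕ
      arcs v = if D v w then x v else 0
      indicator-* : ∀ b k → + (if b then k else 0) ≡ ⟦ b ⟧ * + k
      indicator-* true k = sym (ℤₚ.*-identityˡ (+ k))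
      indicator-* false k = refl
      arcs-pos : ∀ v → + arcs v ≡ A (pos v) (pos w) * Y (pos v)
      arcs-pos v = trans (indicator-* (D v w) (x v)) (cong₂ _*_ (D≡A v w) (x≡Y v))

    feedback-into-first : StronglyConnected D → 1 < n → ∃₂ λ v w → T (F v w) × pos w ≡ 0
    feedback-into-first strong 1<n = map₂ (map₂ (map₂ ℕₚ.n<1⇒n≡0)) (walk-crosses 1 (strong (vertex 1) (vertex 0))
      (ℕₚ.≤-reflexive (sym (pos-vertex 1<n))) (subst (_< 1) (sym (pos-vertex 0<n)) (s≤s z≤n)))
      where
      0<n = ℕₚ.<-trans (s≤s z≤n) 1<n
      instance
        n-nonZero : ℕ.NonZero n
        n-nonZero = ℕ.>-nonZero 0<n

  -- Tournaments whose feedback arcs form a directed path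

  module _ {n} {B : Fin n → Fin n → Bool} {p} {u : Fin p → Fin n}
    (incident : ∀ v → Incident B v ⇔ (∃ λ i → u i ≡ v))
    (arcs : ∀ i j → T (B (u i) (u j)) ⇔ (toℕ j ≡ suc (toℕ i))) where

    path-arc-indices : ∀ {v w} → T (B v w) → ∃₂ λ i j → u i ≡ v × u j ≡ w × toℕ j ≡ suc (toℕ i)
    path-arc-indices {v} {w} t with Equivalence.to (incident v) (w , inj₁ t) | Equivalence.to (incident w) (v , inj₂ t)
    ... | i , ui≡v | j , uj≡w =
      i , j , ui≡v , uj≡w , Equivalence.to (arcs i j) (subst₂ (λ a b → T (B a b)) (sym ui≡v) (sym uj≡w) t)

    path-of-no-vertex : p ≡ 0 → ∀ v w → ¬ T (B v w)
    path-of-no-vertex refl v w t with path-arc-indices t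
    ... | () , _

    path-of-one-vertex-no-arc : p ≡ 1 → ∀ v w → ¬ T (B v w)
    path-of-one-vertex-no-arc refl v w t with path-arc-indices t
    ... | Fin.zero , Fin.zero , _ , _ , ()

    path-of-one-vertex : p ≢ 1
    path-of-one-vertex refl with Equivalence.from (incident (u Fin.zero)) (Fin.zero , refl)
    ... | _ , inj₁ t = path-of-one-vertex-no-arc refl _ _ t
    ... | _ , inj₂ t = path-of-one-vertex-no-arc refl _ _ t

  module FeedbackPath {n} (D : Digraph n) (σ : Ordering n)
    (tournament : IsTournament D) (strong : StronglyConnected D) (minimum : IsMinimumFASOrdering D σ)
    {m₀} (u : Fin (suc (suc m₀)) → Fin n)
    (incident : ∀ v → Incident (feedback D σ) v ⇔ (∃ λ i → u i ≡ v))
    (arcs : ∀ i j → T (feedback D σ (u i) (u j)) ⇔ (toℕ j ≡ suc (toℕ i))) where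

    open Ordered D σ

    m : ℕ
    m = suc m₀

    U : ℕ → Fin n
    U i = u (i mod suc m)

    U-toℕ : ∀ i → U (toℕ i) ≡ u i
    U-toℕ i = cong u (Finₚ.toℕ-injective (trans (Finₚ.toℕ-fromℕ< _) (m<n⇒m%n≡m (Finₚ.toℕ<n i))))

    U-fromℕ< : ∀ {i} (i≤m : i ≤ m) → U i ≡ u (fromℕ< (s≤s i≤m))
    U-fromℕ< i≤m = trans (cong U (sym (Finₚ.toℕ-fromℕ< (s≤s i≤m)))) (U-toℕ _)

    feedback-on-path : ∀ {v w} → T (F v w) → ∃ λ i → i < m × U i ≡ v × U (suc i) ≡ w
    feedback-on-path t with path-arc-indices incident arcs t
    ... | i , j , ui≡v , uj≡w , j≡1+i = toℕ i , ℕₚ.≤-pred (subst (_< suc m) j≡1+i (Finₚ.toℕ<n j))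
                                       , trans (U-toℕ i) ui≡v , trans (cong U (sym j≡1+i)) (trans (U-toℕ j) uj≡w)

    path-arc : ∀ {i} → i < m → T (F (U i) (U (suc i)))
    path-arc {i} i<m = subst₂ (λ a b → T (F a b)) (sym (U-fromℕ< (ℕₚ.<⇒≤ i<m))) (sym (U-fromℕ< i<m))
      (Equivalence.from (arcs _ _) (trans (Finₚ.toℕ-fromℕ< (s≤s i<m)) (cong suc (sym (Finₚ.toℕ-fromℕ< (s≤s (ℕₚ.<⇒≤ i<m)))))))

    Q : ℕ → ℕ
    Q = pos ∘ U

    Q-decreasing : ∀ {i} → i < m → Q (suc i) < Q i
    Q-decreasing i<m = proj₂ (feedback⇒ (path-arc i<m))

    -- An adjacent pair Q i = Q (suc i) + 1 could be swapped to remove a feedback arc.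
    Q-gap : ∀ i → i < m → 2 ℕ.+ Q (suc i) ≤ Q i
    Q-gap i i<m with ℕₚ.m≤n⇒m<n∨m≡n (Q-decreasing i<m)
    ... | inj₁ gap = gap
    ... | inj₂ adjacent with adjacent-feedback-removable tournament (path-arc i<m) (sym adjacent)
    ... | τ , fewer = ⊥-elim (ℕₚ.<⇒≱ fewer (minimum τ))

    Q-start : Q 0 < n
    Q-start = pos<n (U 0)

    1<n : 1 < n
    1<n = ℕₚ.≤-<-trans (ℕₚ.≤-trans (s≤s z≤n) (Q-decreasing (s≤s z≤n))) Q-start

    Q-end : Q m ≡ 0
    Q-end with feedback-into-first strong 1<n
    ... | _ , w , t , pos-w≡0 with feedback-on-path t
    ... | i , i<m , _ , U[1+i]≡w with ℕₚ.m≤n⇒m<n∨m≡n i<m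
    ... | inj₁ 1+i<m = ⊥-elim (ℕₚ.n≮0 (subst (Q (suc (suc i)) <_) (trans (cong pos U[1+i]≡w) pos-w≡0) (Q-decreasing 1+i<m)))
    ... | inj₂ refl = trans (cong pos U[1+i]≡w) pos-w≡0

    instance
      n-nonZero : ℕ.NonZero n
      n-nonZero = ℕ.>-nonZero (ℕₚ.<-trans (s≤s z≤n) 1<n)

    open PositionGame n m₀ Q Q-gap Q-end Q-start hiding (m)

    feedback-pathArc : ∀ v w → ⟦ F v w ⟧ ≡ pathArc (pos v) (pos w)
    feedback-pathArc v w with F v w in eq
    ... | true with feedback-on-path (subst T (sym eq) _)
    ...   | i , i<m , refl , refl = sym (pathArc-Q i<m)
    feedback-pathArc v w | false = sym (pathArc-off not-on-path)
      where
      not-on-path : ∀ {i} → i < m → pos v ≡ Q i → pos w ≡ Q (suc i) → ⊥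
      not-on-path i<m v-at-i w-at-1+i =
        subst T (trans (cong₂ F (sym (pos-injective v-at-i)) (sym (pos-injective w-at-1+i))) eq) (path-arc i<m)

    adjacency-pos : ∀ v w → ⟦ D v w ⟧ ≡ adjacency (pos v) (pos w)
    adjacency-pos v w = trans (tournament-arc tournament v w)
      (cong₂ (λ a b → δ< (pos v) (pos w) + (a - b)) (feedback-pathArc v w) (feedback-pathArc w v))

    finalLabel≡outcome : ∀ lab x (c Y : ℕ → ℤ) → (∀ v → + lab v ≡ c (pos v)) → (∀ v → + x v ≡ Y (pos v)) →
                         ∀ w → + finalLabel D lab x w ≡ outcome c Y (pos w)
    finalLabel≡outcome = finalLabel-in-positions adjacency adjacency-pos

    card-feedback : card F ≡ m
    card-feedback = ℤₚ.+-injective (begin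
      + card F                                      ≡⟨ card-∑ F ⟩
      ∑[ v < n ] ∑[ w < n ] ⟦ F v w ⟧                ≡⟨ sum-cong-≗ (λ v → sum-cong-≗ (feedback-pathArc v)) ⟩
      ∑[ v < n ] ∑[ w < n ] pathArc (pos v) (pos w)  ≡⟨ sum-cong-≗ (λ v → ∑-permute-toℕ σ (pathArc (pos v))) ⟩
      ∑[ v < n ] ∑< n (pathArc (pos v))              ≡⟨ ∑-permute-toℕ σ (λ s → ∑< n (pathArc s)) ⟩
      ∑< n (λ s → ∑< n (λ r → pathArc s r))          ≡⟨ ∑<-∑<-pathArc ⟩
      + m                                            ∎)
      where open ≡-Reasoning

    aw⇒coprime : ∀ {k} → 2 ≤ k → IsAW k D → gcd k (fib (suc (suc m))) ≡ 1
    aw⇒coprime {suc (suc k₀)} _ aw = solvable⇒coprime Y solves (∣ᵤ⇒∣ (gcd[m,n]∣n k (fib (suc (suc m)))))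
      where
      k = suc (suc k₀)
      endLabel : Fin n → Fin k
      endLabel v = if does (pos v ℕ.≟ 0) then Fin.suc Fin.zero else Fin.zero
      x : Fin n → ℕ
      x = proj₁ (aw endLabel)
      Y : ℕ → ℤ
      Y r = + x (vertex r)
      x-pos : ∀ v → + x v ≡ Y (pos v)
      x-pos v = cong (+_ ∘ x) (sym (vertex-pos v))
      endLabel-δ₀ : ∀ v → + toℕ (endLabel v) ≡ δ₀ (pos v)
      endLabel-δ₀ v with does (pos v ℕ.≟ 0)
      ... | true = refl
      ... | false = refl
      solves : ∀ r → r < n → + gcd k (fib (suc (suc m))) ∣ outcome δ₀ Y r
      solves r r<n = ∣-trans (∣ᵤ⇒∣ (gcd[m,n]∣m k (fib (suc (suc m)))))
        (subst (+ k ∣_) (trans (finalLabel≡outcome (toℕ ∘ endLabel) x δ₀ Y endLabel-δ₀ x-pos (vertex r))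
                               (cong (outcome δ₀ Y) (pos-vertex r<n)))
                        (∣ᵤ⇒∣ (proj₂ (aw endLabel) (vertex r))))
    aw⇒coprime {suc zero} (s≤s ())

    coprime⇒aw : ∀ {k} .{{_ : ℕ.NonZero k}} → gcd k (fib (suc (suc m))) ≡ 1 → IsAW k D
    coprime⇒aw {k} coprime lab = x , λ w → ∣⇒∣ᵤ (subst (+ k ∣_) (sym (finalLabel≡outcome (toℕ ∘ lab) x c Y′ c-pos (λ _ → refl) w))
        (outcome-resp-mod c {Y = Y} {Y′ = Y′} rounding (pos w) (solution-solves c a inverse (pos<n w))))
      where
      a = proj₁ (inverse-mod {k} {fib (suc (suc m))} coprime)
      inverse = proj₂ (inverse-mod {k} {fib (suc (suc m))} coprime)
      c : ℕ → ℤ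
      c r = + toℕ (lab (vertex r))
      c-pos : ∀ v → + toℕ (lab v) ≡ c (pos v)
      c-pos v = cong (+_ ∘ toℕ ∘ lab) (sym (vertex-pos v))
      Y : ℕ → ℤ
      Y = solution c a
      Y′ : ℕ → ℤ
      Y′ s = + (Y s %ℕ k)
      x : Fin n → ℕ
      x v = Y (pos v) %ℕ k
      rounding : ∀ s → + k ∣ Y′ s - Y s
      rounding s = divides (- (Y s /ℕ k))
        (trans (cong (_-_ (Y′ s)) (a≡a%ℕn+[a/ℕn]*n (Y s) k)) (cancel (Y′ s) (Y s /ℕ k) (+ k)))
        where
        cancel : ∀ r q d → r - (r + q * d) ≡ - q * d
        cancel = solve-∀

    aw⇔coprime : ∀ {k} → 2 ≤ k → IsAW k D ⇔ (gcd k (fib (card F ℕ.+ 2)) ≡ 1)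
    aw⇔coprime {k} 2≤k =
      subst (λ l → IsAW k D ⇔ (gcd k (fib l) ≡ 1)) (trans (ℕₚ.+-comm 2 m) (cong (ℕ._+ 2) (sym card-feedback)))
        (mk⇔ (aw⇒coprime 2≤k) (coprime⇒aw {{ℕ.>-nonZero (ℕₚ.<-trans (s≤s z≤n) 2≤k)}}))

  card-empty : ∀ {n} {B : Fin n → Fin n → Bool} → (∀ v w → ¬ T (B v w)) → card B ≡ 0
  card-empty {n} {B} empty = ℤₚ.+-injective (begin
    + card B                             ≡⟨ card-∑ B ⟩
    ∑[ v < n ] ∑[ w < n ] ⟦ B v w ⟧      ≡⟨ sum-cong-≗ (λ v → trans (sum-cong-≗ (λ w → cong ⟦_⟧ (¬T⇒≡false (empty v w))))
                                                                  (sum-replicate-zero n)) ⟩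
    ∑[ v < n ] 0ℤ                        ≡⟨ sum-replicate-zero n ⟩
    0ℤ                                   ∎)
    where
    open ≡-Reasoning
    ¬T⇒≡false : ∀ {b} → ¬ T b → b ≡ false
    ¬T⇒≡false {true} ¬t = ⊥-elim (¬t _)
    ¬T⇒≡false {false} _ = refl

  at-most-one-vertex-aw : ∀ {n k} (D : Digraph n) .{{_ : ℕ.NonZero k}} →
                          (∀ v → D v v ≡ false) → n ≤ 1 → IsAW k D
  at-most-one-vertex-aw {zero} D _ _ lab = (λ ()) , λ ()
  at-most-one-vertex-aw {suc zero} {k} D loopless _ lab = (λ _ → k ∸ toℕ (lab Fin.zero)) , wins
    where
    wins : ∀ w → k ℕ.∣ finalLabel D (toℕ ∘ lab) (λ _ → k ∸ toℕ (lab Fin.zero)) w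
    wins Fin.zero rewrite loopless Fin.zero =
      subst (k ℕ.∣_) (sym (trans (ℕₚ.+-identityʳ _) (ℕₚ.m+[n∸m]≡n (ℕₚ.<⇒≤ (Finₚ.toℕ<n (lab Fin.zero)))))) ℕ.∣-refl
  at-most-one-vertex-aw {suc (suc _)} D _ (s≤s ())

  aw⇔coprime-without-feedback : ∀ {n} (D : Digraph n) (σ : Ordering n) → IsTournament D → StronglyConnected D →
    (∀ v w → ¬ T (feedback D σ v w)) →
    ∀ {k} → 2 ≤ k → IsAW k D ⇔ (gcd k (fib (card (feedback D σ) ℕ.+ 2)) ≡ 1)
  aw⇔coprime-without-feedback {n} D σ (loopless , _) strong no-feedback {k} 2≤k =
    subst (λ c → IsAW k D ⇔ (gcd k (fib (c ℕ.+ 2)) ≡ 1)) (sym (card-empty no-feedback))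
      (mk⇔ (λ _ → gcd-zeroʳ k)
           (λ _ → at-most-one-vertex-aw D {{ℕ.>-nonZero (ℕₚ.<-trans (s≤s z≤n) 2≤k)}} loopless n≤1))
    where
    n≤1 : n ≤ 1
    n≤1 = ℕₚ.≮⇒≥ (λ 1<n → let (v , w , t , _) = Ordered.feedback-into-first D σ strong 1<n in no-feedback v w t)

open import Data.Nat using (ℕ; _≤_; _+_; zero; suc)
open import Data.Nat.GCD using (gcd)
open import Data.Product using (_,_)
open import Data.Empty using (⊥-elim)
open import Relation.Binary.PropositionalEquality using (_≡_; refl)
open import Function.Bundles using (_⇔_)
open LightsOut using (module FeedbackPath; aw⇔coprime-without-feedback; path-of-no-vertex; path-of-one-vertex)

mainTheorem4 : ∀ (n : ℕ) (D : Digraph n) (σ : Ordering n) (k : ℕ) →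
    IsTournament D → StronglyConnected D →
    IsMinimumFASOrdering D σ → IsDirectedPath (feedback D σ) →
    2 ≤ k →
    IsAW k D ⇔ (gcd k (fib (card (feedback D σ) + 2)) ≡ 1)
mainTheorem4 n D σ k tournament strong _ (zero , _ , _ , incident , arcs) 2≤k =
  aw⇔coprime-without-feedback D σ tournament strong (path-of-no-vertex incident arcs refl) 2≤k
mainTheorem4 n D σ k _ _ _ (suc zero , _ , _ , incident , arcs) _ =
  ⊥-elim (path-of-one-vertex incident arcs refl)
mainTheorem4 n D σ k tournament strong minimum (suc (suc _) , u , _ , incident , arcs) 2≤k =
  FeedbackPath.aw⇔coprime D σ tournament strong minimum u incident arcs 2≤k
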